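{- For every finite multiset $\Gamma$ of formulas and every formula $C$: $\Gamma\Rightarrow C$ is derivable in $\mathsf{GWFDI}$ if and only if $\vdash_{\mathsf{WFDI}}\bigwedge\Gamma\rightarrow C$.
   Context: Formulas are built from a countable set of propositional atoms and $\bot$ using $\wedge,\vee,\rightarrow$; $A\leftrightarrow B$ abbreviates $(A\rightarrow B)\wedge(B\rightarrow A)$. $\bigwedge\Gamma$ is the conjunction of the formulas of $\Gamma$ (empty conjunction read as $\bot\rightarrow\bot$). Sequent calculus $\mathsf{GWFDI}$ (sequents $\Gamma\Rightarrow C$, $\Gamma$ finite multiset, $C$ a formula, $p$ atomic): (Ax) $p,\Gamma\Rightarrow p$; ($\bot_L$) $\bot,\Gamma\Rightarrow C$; ($\wedge_L$) from $A,B,\Gamma\Rightarrow C$ infer $A\wedge B,\Gamma\Rightarrow C$; ($\wedge_R$) from $\Gamma\Rightarrow A$ and $\Gamma\Rightarrow B$ infer $\Gamma\Rightarrow A\wedge B$; ($\vee_L$) from $A,\Gamma\Rightarrow C$ and $B,\Gamma\Rightarrow C$ infer $A\vee B,\Gamma\Rightarrow C$; ($\vee_R^1$) from $\Gamma\Rightarrow A$ infer $\Gamma\Rightarrow A\vee B$; ($\vee_R^2$) from $\Gamma\Rightarrow B$ infer $\Gamma\Rightarrow A\vee B$; ($\rightarrow_R$) from $A\Rightarrow B$ infer $\Gamma\Rightarrow A\rightarrow B$; ($\rightarrow_{LR}$) from $A\Rightarrow B$, $B\Rightarrow A$, $C\Rightarrow D$, $D\Rightarrow C$ infer $\Gamma,A\rightarrow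 C\Rightarrow B\rightarrow D$; ($\rightarrow_I$) from $\Gamma\Rightarrow B\rightarrow C$ and $\Gamma\Rightarrow C\rightarrow D$ infer $\Gamma\Rightarrow B\rightarrow D$; ($\rightarrow_D$) from $\Gamma\Rightarrow B\rightarrow C$ and $\Gamma\Rightarrow D\rightarrow C$ infer $\Gamma\Rightarrow B\vee D\rightarrow C$. Hilbert system $\mathsf{WF}$: axioms all instances of $A\rightarrow(A\vee B)$; $B\rightarrow(A\vee B)$; $(A\wedge B)\rightarrow A$; $(A\wedge B)\rightarrow B$; $A\wedge(B\vee C)\rightarrow(A\wedge B)\vee(A\wedge C)$; $A\rightarrow A$; $\bot\rightarrow A$; rules: from $A$, $A\rightarrow B$ infer $B$; from $A$ infer $B\rightarrow A$; from $A\rightarrow B$, $B\rightarrow C$ infer $A\rightarrow C$; from $A\rightarrow B$, $A\rightarrow C$ infer $A\rightarrow(B\wedge C)$; from $A\rightarrow C$, $B\rightarrow C$ infer $(A\vee B)\rightarrow C$; from $A$, $B$ infer $A\wedge B$; from $A\leftrightarrow B$, $C\leftrightarrow D$ infer $(A\rightarrow C)\leftrightarrow(B\rightarrow D)$. $\mathsf{WFDI}$ is $\mathsf{WF}$ plus all instances of the axioms $(A\rightarrow B)\wedge(B\rightarrow C)\rightarrow(A\rightarrow C)$ and $(A\rightarrow C)\wedge(B\rightarrow C)\rightarrow(A\vee B\rightarrow C)$. -}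

module Defs where

open import Data.Nat using (ℕ)
open import Data.List using (List; []; _∷_)
open import Data.List.Relation.Binary.Permutation.Propositional using (_↭_)

data Fm : Set where
  atom : ℕ → Fm
  ⊥'   : Fm
  _∧'_ : Fm → Fm → Fm
  _∨'_ : Fm → Fm → Fm
  _⇒_  : Fm → Fm → Fm

infixr 6 _∧'_
infixr 5 _∨'_
infixr 4 _⇒_

_⇔_ : Fm → Fm → Fm
A ⇔ B = (A ⇒ B) ∧' (B ⇒ A)

⊤' : Fm
⊤' = ⊥' ⇒ ⊥'

⋀ : List Fm → Fm
⋀ []           = ⊤'
⋀ (A ∷ [])     = A
⋀ (A ∷ B ∷ Γ)  = A ∧' ⋀ (B ∷ Γ)

-- Sequent calculus GWFDI.  Contexts are finite multisets, represented by
-- lists up to permutation: a rule whose conclusion is  F , Γ ⇒ C  applies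
-- to any list Δ that is a permutation of  F ∷ Γ.
infix 2 _⊢_
data _⊢_ : List Fm → Fm → Set where
  ax   : ∀ {Δ Γ} p → Δ ↭ (atom p ∷ Γ) → Δ ⊢ atom p
  ⊥L   : ∀ {Δ Γ C} → Δ ↭ (⊥' ∷ Γ) → Δ ⊢ C
  ∧L   : ∀ {Δ Γ A B C} → Δ ↭ ((A ∧' B) ∷ Γ) → (A ∷ B ∷ Γ) ⊢ C → Δ ⊢ C
  ∧R   : ∀ {Γ A B} → Γ ⊢ A → Γ ⊢ B → Γ ⊢ A ∧' B
  ∨L   : ∀ {Δ Γ A B C} → Δ ↭ ((A ∨' B) ∷ Γ) → (A ∷ Γ) ⊢ C → (B ∷ Γ) ⊢ C → Δ ⊢ C
  ∨R₁  : ∀ {Γ A B} → Γ ⊢ A → Γ ⊢ A ∨' B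
  ∨R₂  : ∀ {Γ A B} → Γ ⊢ B → Γ ⊢ A ∨' B
  ⇒R   : ∀ {Γ A B} → (A ∷ []) ⊢ B → Γ ⊢ A ⇒ B
  ⇒LR  : ∀ {Δ Γ A B C D} → Δ ↭ ((A ⇒ C) ∷ Γ) →
         (A ∷ []) ⊢ B → (B ∷ []) ⊢ A → (C ∷ []) ⊢ D → (D ∷ []) ⊢ C →
         Δ ⊢ B ⇒ D
  ⇒I   : ∀ {Γ B C D} → Γ ⊢ B ⇒ C → Γ ⊢ C ⇒ D → Γ ⊢ B ⇒ D
  ⇒D   : ∀ {Γ B C D} → Γ ⊢ B ⇒ C → Γ ⊢ D ⇒ C → Γ ⊢ (B ∨' D) ⇒ C

-- Hilbert system WFDI  (WF plus axioms I and D)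
data WFDI : Fm → Set where
  ∨i₁   : ∀ A B → WFDI (A ⇒ A ∨' B)
  ∨i₂   : ∀ A B → WFDI (B ⇒ A ∨' B)
  ∧e₁   : ∀ A B → WFDI (A ∧' B ⇒ A)
  ∧e₂   : ∀ A B → WFDI (A ∧' B ⇒ B)
  dist  : ∀ A B C → WFDI (A ∧' (B ∨' C) ⇒ (A ∧' B) ∨' (A ∧' C))
  idA   : ∀ A → WFDI (A ⇒ A)
  efq   : ∀ A → WFDI (⊥' ⇒ A)
  mp    : ∀ {A B} → WFDI A → WFDI (A ⇒ B) → WFDI B
  wk    : ∀ {A} B → WFDI A → WFDI (B ⇒ A)
  trans : ∀ {A B C} → WFDI (A ⇒ B) → WFDI (B ⇒ C) → WFDI (A ⇒ C)
  ∧rule : ∀ {A B C} → WFDI (A ⇒ B) → WFDI (A ⇒ C) → WFDI (A ⇒ B ∧' C)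
  ∨rule : ∀ {A B C} → WFDI (A ⇒ C) → WFDI (B ⇒ C) → WFDI (A ∨' B ⇒ C)
  ∧I    : ∀ {A B} → WFDI A → WFDI B → WFDI (A ∧' B)
  cong⇒ : ∀ {A B C D} → WFDI (A ⇔ B) → WFDI (C ⇔ D) →
          WFDI ((A ⇒ C) ⇔ (B ⇒ D))
  axI   : ∀ A B C → WFDI ((A ⇒ B) ∧' (B ⇒ C) ⇒ (A ⇒ C))
  axD   : ∀ A B C → WFDI ((A ⇒ C) ∧' (B ⇒ C) ⇒ (A ∨' B ⇒ C))

{-# OPTIONS --safe #-}
-- Soundness: reading a context as the conjunction of its formulas, every
-- rule of GWFDI is a derived rule of WFDI; permutations of the context are
-- harmless because the ⊤-terminated right-nested conjunction is provably
-- invariant under them.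
--
-- Completeness: every axiom of WFDI is derivable and every rule admissible
-- in GWFDI.  Modus ponens and transitivity need cut, which is admissible by
-- induction on the cut formula and then on the derivation.  An implication is
-- principal on the left only in →LR, and there a cut on A → C with conclusion
-- B → D is replaced by two applications of →I along B → A → C → D; so only
-- conjunctions and disjunctions require cuts on their subformulas.
module Submission where

open import Data.Empty using (⊥-elim)
open import Data.List using (List; []; _∷_; _++_; [_]; foldr)
open import Data.List.Membership.Propositional.Properties using (∈-∃++)
open import Data.List.Relation.Binary.Permutation.Propositional
  using (_↭_; ↭-refl; ↭-sym; ↭-trans; ↭-prep; ↭-swap)
import Data.List.Relation.Binary.Permutation.Propositional as ↭
open import Data.List.Relation.Binary.Permutation.Propositional.Properties
  using (++⁺ˡ; shift; shifts; drop-∷; ∈-resp-↭; ¬x∷xs↭[]; ++-comm)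
open import Data.List.Relation.Unary.Any using (here; there)
open import Data.Product using (_×_; _,_; proj₁; proj₂; map; zip′)
open import Data.Unit using (⊤; tt)
open import Relation.Binary.PropositionalEquality using (refl)

open import Defs

module _ {a} {A : Set a} where

  -- Matching on `same` unifies the two removed elements, so it is an absurd
  -- case, left out below, whenever they are formulas of different shapes.
  data Overlap (x : A) (xs : List A) : A → List A → Set a where
    same  : ∀ {ys} → xs ↭ ys → Overlap x xs x ys
    apart : ∀ {y ys} zs → xs ↭ y ∷ zs → ys ↭ x ∷ zs → Overlap x xs y ys

  ↭-overlap : ∀ {zs x xs y ys} → zs ↭ x ∷ xs → zs ↭ y ∷ ys → Overlap x xs y ys
  ↭-overlap p q = heads (↭-trans (↭-sym p) q)
    where
    heads : ∀ {x xs y ys} → x ∷ xs ↭ y ∷ ys → Overlap x xs y ys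
    heads {x} {y = y} p with ∈-resp-↭ p (here refl)
    ... | here refl = same (drop-∷ p)
    ... | there x∈ys with us , vs , refl ← ∈-∃++ x∈ys =
      apart (us ++ vs)
            (drop-∷ (↭-trans p (↭-trans (↭-prep y (shift x us vs)) (↭-swap y x ↭-refl))))
            (shift x us vs)

  ++⁺ˡ-shift : ∀ (ws : List A) {x xs ys} → xs ↭ x ∷ ys → ws ++ xs ↭ x ∷ ws ++ ys
  ++⁺ˡ-shift ws {x} {ys = ys} p = ↭-trans (++⁺ˡ ws p) (shift x ws ys)

⋀⊤ : List Fm → Fm
⋀⊤ = foldr _∧'_ ⊤'

∧⊤-intro : ∀ A → WFDI (A ⇒ A ∧' ⊤')
∧⊤-intro A = ∧rule (idA A) (wk A (idA ⊥'))

∧-monoʳ : ∀ {A B C} → WFDI (B ⇒ C) → WFDI (A ∧' B ⇒ A ∧' C)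
∧-monoʳ h = ∧rule (∧e₁ _ _) (trans (∧e₂ _ _) h)

∧-comm : ∀ A B → WFDI (A ∧' B ⇒ B ∧' A)
∧-comm A B = ∧rule (∧e₂ A B) (∧e₁ A B)

∧-assoc : ∀ A B C → WFDI ((A ∧' B) ∧' C ⇒ A ∧' (B ∧' C))
∧-assoc A B C =
  ∧rule (trans (∧e₁ _ _) (∧e₁ A B)) (∧rule (trans (∧e₁ _ _) (∧e₂ A B)) (∧e₂ _ C))

∧-exchange : ∀ A B C → WFDI (A ∧' (B ∧' C) ⇒ B ∧' (A ∧' C))
∧-exchange A B C = ∧rule (trans (∧e₂ _ _) (∧e₁ B C)) (∧-monoʳ (∧e₂ B C))

∨∧-distribʳ : ∀ A B C → WFDI ((A ∨' B) ∧' C ⇒ (A ∧' C) ∨' (B ∧' C))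
∨∧-distribʳ A B C =
  trans (∧-comm _ _)
        (trans (dist C A B)
               (∨rule (trans (∧-comm C A) (∨i₁ _ _)) (trans (∧-comm C B) (∨i₂ _ _))))

⋀⇒⋀⊤ : ∀ Γ → WFDI (⋀ Γ ⇒ ⋀⊤ Γ)
⋀⇒⋀⊤ []          = idA ⊤'
⋀⇒⋀⊤ (A ∷ [])     = ∧⊤-intro A
⋀⇒⋀⊤ (A ∷ B ∷ Γ)  = ∧-monoʳ (⋀⇒⋀⊤ (B ∷ Γ))

⋀⊤-resp-↭ : ∀ {Γ Δ} → Γ ↭ Δ → WFDI (⋀⊤ Γ ⇒ ⋀⊤ Δ)
⋀⊤-resp-↭ ↭.refl         = idA _
⋀⊤-resp-↭ (↭.prep A p)   = ∧-monoʳ (⋀⊤-resp-↭ p)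
⋀⊤-resp-↭ (↭.swap A B p) = trans (∧-monoʳ (∧-monoʳ (⋀⊤-resp-↭ p))) (∧-exchange A B _)
⋀⊤-resp-↭ (↭.trans p q)  = trans (⋀⊤-resp-↭ p) (⋀⊤-resp-↭ q)

⇔-intro : ∀ {A B} → WFDI (A ∧' ⊤' ⇒ B) → WFDI (B ∧' ⊤' ⇒ A) → WFDI (A ⇔ B)
⇔-intro h k = ∧I (trans (∧⊤-intro _) h) (trans (∧⊤-intro _) k)

⊢⇒WFDI : ∀ {Γ C} → Γ ⊢ C → WFDI (⋀⊤ Γ ⇒ C)
⊢⇒WFDI (ax p q)     = trans (⋀⊤-resp-↭ q) (∧e₁ _ _)
⊢⇒WFDI (⊥L q)       = trans (⋀⊤-resp-↭ q) (trans (∧e₁ _ _) (efq _))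
⊢⇒WFDI (∧L q d)     = trans (⋀⊤-resp-↭ q) (trans (∧-assoc _ _ _) (⊢⇒WFDI d))
⊢⇒WFDI (∨L q d e)   =
  trans (⋀⊤-resp-↭ q) (trans (∨∧-distribʳ _ _ _) (∨rule (⊢⇒WFDI d) (⊢⇒WFDI e)))
⊢⇒WFDI (∧R d e)     = ∧rule (⊢⇒WFDI d) (⊢⇒WFDI e)
⊢⇒WFDI (∨R₁ d)      = trans (⊢⇒WFDI d) (∨i₁ _ _)
⊢⇒WFDI (∨R₂ d)      = trans (⊢⇒WFDI d) (∨i₂ _ _)
⊢⇒WFDI (⇒R d)       = wk _ (trans (∧⊤-intro _) (⊢⇒WFDI d))
⊢⇒WFDI (⇒LR q ab ba cd dc) =
  trans (⋀⊤-resp-↭ q)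
        (trans (∧e₁ _ _)
               (mp (cong⇒ (⇔-intro (⊢⇒WFDI ab) (⊢⇒WFDI ba)) (⇔-intro (⊢⇒WFDI cd) (⊢⇒WFDI dc)))
                   (∧e₁ _ _)))
⊢⇒WFDI (⇒I d e)     = trans (∧rule (⊢⇒WFDI d) (⊢⇒WFDI e)) (axI _ _ _)
⊢⇒WFDI (⇒D d e)     = trans (∧rule (⊢⇒WFDI d) (⊢⇒WFDI e)) (axD _ _ _)

soundness : ∀ {Γ C} → Γ ⊢ C → WFDI (⋀ Γ ⇒ C)
soundness {Γ} d = trans (⋀⇒⋀⊤ Γ) (⊢⇒WFDI d)

⊢-resp-↭ : ∀ {Δ Δ′ C} → Δ ↭ Δ′ → Δ ⊢ C → Δ′ ⊢ C
⊢-resp-↭ π (ax p q)          = ax p (↭-trans (↭-sym π) q)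
⊢-resp-↭ π (⊥L q)            = ⊥L (↭-trans (↭-sym π) q)
⊢-resp-↭ π (∧L q d)          = ∧L (↭-trans (↭-sym π) q) d
⊢-resp-↭ π (∨L q d e)        = ∨L (↭-trans (↭-sym π) q) d e
⊢-resp-↭ π (∧R d e)          = ∧R (⊢-resp-↭ π d) (⊢-resp-↭ π e)
⊢-resp-↭ π (∨R₁ d)           = ∨R₁ (⊢-resp-↭ π d)
⊢-resp-↭ π (∨R₂ d)           = ∨R₂ (⊢-resp-↭ π d)
⊢-resp-↭ π (⇒R d)            = ⇒R d
⊢-resp-↭ π (⇒LR q ab ba cd dc) = ⇒LR (↭-trans (↭-sym π) q) ab ba cd dc
⊢-resp-↭ π (⇒I d e)          = ⇒I (⊢-resp-↭ π d) (⊢-resp-↭ π e)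
⊢-resp-↭ π (⇒D d e)          = ⇒D (⊢-resp-↭ π d) (⊢-resp-↭ π e)

∧L-under : ∀ L {Γ Θ A B C} → Γ ↭ (A ∧' B) ∷ Θ → L ++ A ∷ B ∷ Θ ⊢ C → L ++ Γ ⊢ C
∧L-under L {A = A} {B} r d = ∧L (++⁺ˡ-shift L r) (⊢-resp-↭ (shifts L (A ∷ B ∷ [])) d)

∨L-under : ∀ L {Γ Θ A B C} → Γ ↭ (A ∨' B) ∷ Θ →
           L ++ A ∷ Θ ⊢ C → L ++ B ∷ Θ ⊢ C → L ++ Γ ⊢ C
∨L-under L {A = A} {B} r d e =
  ∨L (++⁺ˡ-shift L r) (⊢-resp-↭ (shifts L [ A ]) d) (⊢-resp-↭ (shifts L [ B ]) e)

weaken : ∀ L {Γ C} → Γ ⊢ C → L ++ Γ ⊢ C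
weaken L (ax p q)            = ax p (++⁺ˡ-shift L q)
weaken L (⊥L q)              = ⊥L (++⁺ˡ-shift L q)
weaken L (∧L q d)            = ∧L-under L q (weaken L d)
weaken L (∨L q d e)          = ∨L-under L q (weaken L d) (weaken L e)
weaken L (∧R d e)            = ∧R (weaken L d) (weaken L e)
weaken L (∨R₁ d)             = ∨R₁ (weaken L d)
weaken L (∨R₂ d)             = ∨R₂ (weaken L d)
weaken L (⇒R d)              = ⇒R d
weaken L (⇒LR q ab ba cd dc) = ⇒LR (++⁺ˡ-shift L q) ab ba cd dc
weaken L (⇒I d e)            = ⇒I (weaken L d) (weaken L e)
weaken L (⇒D d e)            = ⇒D (weaken L d) (weaken L e)

⊢-id  : ∀ A Γ → A ∷ Γ ⊢ A
⊢-id₂ : ∀ A B Γ → A ∷ B ∷ Γ ⊢ B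

⊢-id (atom p) Γ = ax p ↭-refl
⊢-id ⊥'       Γ = ⊥L ↭-refl
⊢-id (A ∧' B) Γ = ∧L ↭-refl (∧R (⊢-id A (B ∷ Γ)) (⊢-id₂ A B Γ))
⊢-id (A ∨' B) Γ = ∨L ↭-refl (∨R₁ (⊢-id A Γ)) (∨R₂ (⊢-id B Γ))
⊢-id (A ⇒ B)  Γ = ⇒LR ↭-refl (⊢-id A []) (⊢-id A []) (⊢-id B []) (⊢-id B [])

⊢-id₂ A B Γ = ⊢-resp-↭ (↭-swap B A ↭-refl) (⊢-id B (A ∷ Γ))

⊢⊥-elim : ∀ {Γ C} → Γ ⊢ ⊥' → Γ ⊢ C
⊢⊥-elim (⊥L q)     = ⊥L q
⊢⊥-elim (∧L q d)   = ∧L q (⊢⊥-elim d)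
⊢⊥-elim (∨L q d e) = ∨L q (⊢⊥-elim d) (⊢⊥-elim e)

∧R-inv : ∀ {Γ A B} → Γ ⊢ A ∧' B → (Γ ⊢ A) × (Γ ⊢ B)
∧R-inv (⊥L q)     = ⊥L q , ⊥L q
∧R-inv (∧L q d)   = map (∧L q) (∧L q) (∧R-inv d)
∧R-inv (∨L q d e) = zip′ (∨L q) (∨L q) (∧R-inv d) (∧R-inv e)
∧R-inv (∧R d e)   = d , e

∧L-inv : ∀ {Δ Γ X Y C} → Δ ↭ (X ∧' Y) ∷ Γ → Δ ⊢ C → X ∷ Y ∷ Γ ⊢ C
∧L-inv {X = X} {Y} π (ax p q) with ↭-overlap π q
... | apart _ r _ = ax p (++⁺ˡ-shift (X ∷ Y ∷ []) r)
∧L-inv {X = X} {Y} π (⊥L q) with ↭-overlap π q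
... | apart _ r _ = ⊥L (++⁺ˡ-shift (X ∷ Y ∷ []) r)
∧L-inv {X = X} {Y} π (∧L {A = A} {B} q d) with ↭-overlap π q
... | same r = ⊢-resp-↭ (↭-prep X (↭-prep Y (↭-sym r))) d
... | apart _ r s =
  ∧L-under (X ∷ Y ∷ []) r (∧L-inv (++⁺ˡ-shift (A ∷ B ∷ []) s) d)
∧L-inv {X = X} {Y} π (∨L {A = A} {B} q d e) with ↭-overlap π q
... | apart _ r s =
  ∨L-under (X ∷ Y ∷ []) r (∧L-inv (++⁺ˡ-shift [ A ] s) d) (∧L-inv (++⁺ˡ-shift [ B ] s) e)
∧L-inv π (∧R d e) = ∧R (∧L-inv π d) (∧L-inv π e)
∧L-inv π (∨R₁ d)  = ∨R₁ (∧L-inv π d)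
∧L-inv π (∨R₂ d)  = ∨R₂ (∧L-inv π d)
∧L-inv π (⇒R d)   = ⇒R d
∧L-inv {X = X} {Y} π (⇒LR q ab ba cd dc) with ↭-overlap π q
... | apart _ r _ = ⇒LR (++⁺ˡ-shift (X ∷ Y ∷ []) r) ab ba cd dc
∧L-inv π (⇒I d e) = ⇒I (∧L-inv π d) (∧L-inv π e)
∧L-inv π (⇒D d e) = ⇒D (∧L-inv π d) (∧L-inv π e)

∨L-inv : ∀ {Δ Γ X Y C} → Δ ↭ (X ∨' Y) ∷ Γ → Δ ⊢ C → (X ∷ Γ ⊢ C) × (Y ∷ Γ ⊢ C)
∨L-inv {X = X} {Y} π (ax p q) with ↭-overlap π q
... | apart _ r _ = ax p (++⁺ˡ-shift [ X ] r) , ax p (++⁺ˡ-shift [ Y ] r)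
∨L-inv {X = X} {Y} π (⊥L q) with ↭-overlap π q
... | apart _ r _ = ⊥L (++⁺ˡ-shift [ X ] r) , ⊥L (++⁺ˡ-shift [ Y ] r)
∨L-inv {X = X} {Y} π (∧L {A = A} {B} q d) with ↭-overlap π q
... | apart _ r s =
  map (∧L-under [ X ] r) (∧L-under [ Y ] r) (∨L-inv (++⁺ˡ-shift (A ∷ B ∷ []) s) d)
∨L-inv {X = X} {Y} π (∨L {A = A} {B} q d e) with ↭-overlap π q
... | same r = ⊢-resp-↭ (↭-prep X (↭-sym r)) d , ⊢-resp-↭ (↭-prep Y (↭-sym r)) e
... | apart _ r s =
  zip′ (∨L-under [ X ] r) (∨L-under [ Y ] r)
       (∨L-inv (++⁺ˡ-shift [ A ] s) d) (∨L-inv (++⁺ˡ-shift [ B ] s) e)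
∨L-inv π (∧R d e) = zip′ ∧R ∧R (∨L-inv π d) (∨L-inv π e)
∨L-inv π (∨R₁ d)  = map ∨R₁ ∨R₁ (∨L-inv π d)
∨L-inv π (∨R₂ d)  = map ∨R₂ ∨R₂ (∨L-inv π d)
∨L-inv π (⇒R d)   = ⇒R d , ⇒R d
∨L-inv {X = X} {Y} π (⇒LR q ab ba cd dc) with ↭-overlap π q
... | apart _ r _ = ⇒LR (++⁺ˡ-shift [ X ] r) ab ba cd dc , ⇒LR (++⁺ˡ-shift [ Y ] r) ab ba cd dc
∨L-inv π (⇒I d e) = zip′ ⇒I ⇒I (∨L-inv π d) (∨L-inv π e)
∨L-inv π (⇒D d e) = zip′ ⇒D ⇒D (∨L-inv π d) (∨L-inv π e)

Cut : Fm → Set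
Cut A = ∀ {Γ Δ C} → Γ ⊢ A → Δ ↭ A ∷ Γ → Δ ⊢ C → Γ ⊢ C

CutBelow : Fm → Set
CutBelow (A ∧' B) = Cut A × Cut B
CutBelow (A ∨' B) = Cut A × Cut B
CutBelow _        = ⊤

∨-cut : ∀ {Γ A B C} → Cut A → Cut B → Γ ⊢ A ∨' B → A ∷ Γ ⊢ C → B ∷ Γ ⊢ C → Γ ⊢ C
∨-cut cutA cutB (∨R₁ d) dA dB = cutA d ↭-refl dA
∨-cut cutA cutB (∨R₂ d) dA dB = cutB d ↭-refl dB
∨-cut cutA cutB (⊥L q)  dA dB = ⊥L q
∨-cut {Γ} {C = C} cutA cutB (∧L {Γ = Θ} {A = X} {Y} q d) dA dB =
  ∧L q (∨-cut cutA cutB d (invert dA) (invert dB))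
  where
  invert : ∀ {F} → F ∷ Γ ⊢ C → F ∷ X ∷ Y ∷ Θ ⊢ C
  invert {F} dF = ⊢-resp-↭ (shifts (X ∷ Y ∷ []) [ F ]) (∧L-inv (++⁺ˡ-shift [ F ] q) dF)
∨-cut {Γ} {C = C} cutA cutB (∨L {Γ = Θ} {A = X} {Y} q d e) dA dB =
  ∨L q (∨-cut cutA cutB d (proj₁ (invert dA)) (proj₁ (invert dB)))
       (∨-cut cutA cutB e (proj₂ (invert dA)) (proj₂ (invert dB)))
  where
  invert : ∀ {F} → F ∷ Γ ⊢ C → (F ∷ X ∷ Θ ⊢ C) × (F ∷ Y ∷ Θ ⊢ C)
  invert {F} dF = map (⊢-resp-↭ (shifts [ X ] [ F ])) (⊢-resp-↭ (shifts [ Y ] [ F ]))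
                      (∨L-inv (++⁺ˡ-shift [ F ] q) dF)

cutBelow⇒cut : ∀ A → CutBelow A → Cut A
cutBelow⇒cut A below d₀ π (ax p q) with ↭-overlap π q
... | same _      = d₀
... | apart _ r _ = ax p r
cutBelow⇒cut A below d₀ π (⊥L q) with ↭-overlap π q
... | same _      = ⊢⊥-elim d₀
... | apart _ r _ = ⊥L r
cutBelow⇒cut A below d₀ π (∧L {A = X} {Y} q d) with ↭-overlap π q
cutBelow⇒cut .(X ∧' Y) (cutX , cutY) d₀ π (∧L {A = X} {Y} q d) | same r =
  let dX , dY = ∧R-inv d₀
      π′ = ↭-trans (↭-prep X (↭-prep Y (↭-sym r))) (↭-swap X Y ↭-refl)
  in cutX dX ↭-refl (cutY (weaken [ X ] dY) π′ d)
... | apart _ r s = ∧L r (cutBelow⇒cut A below (∧L-inv r d₀) (++⁺ˡ-shift (X ∷ Y ∷ []) s) d)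
cutBelow⇒cut A below d₀ π (∨L {A = X} {Y} q d e) with ↭-overlap π q
cutBelow⇒cut .(X ∨' Y) (cutX , cutY) d₀ π (∨L {A = X} {Y} q d e) | same r =
  ∨-cut cutX cutY d₀ (⊢-resp-↭ (↭-prep X (↭-sym r)) d) (⊢-resp-↭ (↭-prep Y (↭-sym r)) e)
... | apart _ r s =
  ∨L r (cutBelow⇒cut A below (proj₁ (∨L-inv r d₀)) (++⁺ˡ-shift [ X ] s) d)
       (cutBelow⇒cut A below (proj₂ (∨L-inv r d₀)) (++⁺ˡ-shift [ Y ] s) e)
cutBelow⇒cut A below d₀ π (∧R d e) =
  ∧R (cutBelow⇒cut A below d₀ π d) (cutBelow⇒cut A below d₀ π e)
cutBelow⇒cut A below d₀ π (∨R₁ d)  = ∨R₁ (cutBelow⇒cut A below d₀ π d)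
cutBelow⇒cut A below d₀ π (∨R₂ d)  = ∨R₂ (cutBelow⇒cut A below d₀ π d)
cutBelow⇒cut A below d₀ π (⇒R d)   = ⇒R d
cutBelow⇒cut A below d₀ π (⇒LR q ab ba cd dc) with ↭-overlap π q
... | same _      = ⇒I (⇒I (⇒R ba) d₀) (⇒R cd)
... | apart _ r _ = ⇒LR r ab ba cd dc
cutBelow⇒cut A below d₀ π (⇒I d e) =
  ⇒I (cutBelow⇒cut A below d₀ π d) (cutBelow⇒cut A below d₀ π e)
cutBelow⇒cut A below d₀ π (⇒D d e) =
  ⇒D (cutBelow⇒cut A below d₀ π d) (cutBelow⇒cut A below d₀ π e)

cut : ∀ A → Cut A
cut (atom p) = cutBelow⇒cut (atom p) tt
cut ⊥'       = cutBelow⇒cut ⊥' tt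
cut (A ∧' B) = cutBelow⇒cut (A ∧' B) (cut A , cut B)
cut (A ∨' B) = cutBelow⇒cut (A ∨' B) (cut A , cut B)
cut (A ⇒ B)  = cutBelow⇒cut (A ⇒ B) tt

-- Only for the empty context: otherwise →LR may conclude an implication.
⇒R-inv : ∀ {A B} → [] ⊢ A ⇒ B → A ∷ [] ⊢ B
⇒R-inv (⊥L q)            = ⊥-elim (¬x∷xs↭[] (↭-sym q))
⇒R-inv (∧L q _)          = ⊥-elim (¬x∷xs↭[] (↭-sym q))
⇒R-inv (∨L q _ _)        = ⊥-elim (¬x∷xs↭[] (↭-sym q))
⇒R-inv (⇒LR q _ _ _ _)   = ⊥-elim (¬x∷xs↭[] (↭-sym q))
⇒R-inv (⇒R d)            = d
⇒R-inv {A} (⇒I {C = B} d e) = cut B (⇒R-inv d) (↭-swap A B ↭-refl) (weaken [ A ] (⇒R-inv e))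
⇒R-inv (⇒D d e)          = ∨L ↭-refl (⇒R-inv d) (⇒R-inv e)

⇔-inv : ∀ {A B} → [] ⊢ A ⇔ B → (A ∷ [] ⊢ B) × (B ∷ [] ⊢ A)
⇔-inv d = map ⇒R-inv ⇒R-inv (∧R-inv d)

WFDI⇒⊢ : ∀ {F} → WFDI F → [] ⊢ F
WFDI⇒⊢ (∨i₁ A B)    = ⇒R (∨R₁ (⊢-id A []))
WFDI⇒⊢ (∨i₂ A B)    = ⇒R (∨R₂ (⊢-id B []))
WFDI⇒⊢ (∧e₁ A B)    = ⇒R (∧L ↭-refl (⊢-id A [ B ]))
WFDI⇒⊢ (∧e₂ A B)    = ⇒R (∧L ↭-refl (⊢-id₂ A B []))
WFDI⇒⊢ (dist A B C) =
  ⇒R (∧L ↭-refl (∨L (↭-swap A (B ∨' C) ↭-refl)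
                     (∨R₁ (∧R (⊢-id₂ B A []) (⊢-id B [ A ])))
                     (∨R₂ (∧R (⊢-id₂ C A []) (⊢-id C [ A ])))))
WFDI⇒⊢ (idA A)      = ⇒R (⊢-id A [])
WFDI⇒⊢ (efq A)      = ⇒R (⊥L ↭-refl)
WFDI⇒⊢ (mp {A} d e) = cut A (WFDI⇒⊢ d) ↭-refl (⇒R-inv (WFDI⇒⊢ e))
WFDI⇒⊢ (wk B d)     = ⇒R (weaken [ B ] (WFDI⇒⊢ d))
WFDI⇒⊢ (trans d e)  = ⇒I (WFDI⇒⊢ d) (WFDI⇒⊢ e)
WFDI⇒⊢ (∧rule d e)  = ⇒R (∧R (⇒R-inv (WFDI⇒⊢ d)) (⇒R-inv (WFDI⇒⊢ e)))
WFDI⇒⊢ (∨rule d e)  = ⇒D (WFDI⇒⊢ d) (WFDI⇒⊢ e)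
WFDI⇒⊢ (∧I d e)     = ∧R (WFDI⇒⊢ d) (WFDI⇒⊢ e)
WFDI⇒⊢ (cong⇒ d e) with ⇔-inv (WFDI⇒⊢ d) | ⇔-inv (WFDI⇒⊢ e)
... | ab , ba | cd , dc = ∧R (⇒R (⇒LR ↭-refl ab ba cd dc)) (⇒R (⇒LR ↭-refl ba ab dc cd))
WFDI⇒⊢ (axI A B C)  = ⇒R (∧L ↭-refl (⇒I (⊢-id (A ⇒ B) [ B ⇒ C ]) (⊢-id₂ (A ⇒ B) (B ⇒ C) [])))
WFDI⇒⊢ (axD A B C)  = ⇒R (∧L ↭-refl (⇒D (⊢-id (A ⇒ C) [ B ⇒ C ]) (⊢-id₂ (A ⇒ C) (B ⇒ C) [])))

⊢⋀ : ∀ Γ → Γ ⊢ ⋀ Γ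
⊢⋀ []          = ⇒R (⊥L ↭-refl)
⊢⋀ (A ∷ [])    = ⊢-id A []
⊢⋀ (A ∷ B ∷ Γ) = ∧R (⊢-id A (B ∷ Γ)) (weaken [ A ] (⊢⋀ (B ∷ Γ)))

completeness : ∀ Γ {C} → WFDI (⋀ Γ ⇒ C) → Γ ⊢ C
completeness Γ h = cut (⋀ Γ) (⊢⋀ Γ) (++-comm Γ [ ⋀ Γ ]) (weaken Γ (⇒R-inv (WFDI⇒⊢ h)))

mainTheorem20 : (Γ : List Fm) (C : Fm) →
                ((Γ ⊢ C) → WFDI (⋀ Γ ⇒ C)) × (WFDI (⋀ Γ ⇒ C) → (Γ ⊢ C))
mainTheorem20 Γ C = soundness , completeness Γ
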